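{- Let $G$ be a finite group with subgroups $H,K$ such that $G\neq HK$, $G$ acts faithfully and $2$-homogeneously on the set $[G:H]$ of right cosets of $H$, $H$ acts $2$-homogeneously on $[H:H\cap K]$, and $K$ acts $2$-homogeneously on $[K:H\cap K]$. Let $\mathcal P=[G:H]$, $\mathcal B=[G:K]$, and declare $Hx\in\mathcal P$ incident with $Ky\in\mathcal B$ if and only if $Hx\cap Ky\neq\emptyset$. Then $\mathcal D=(\mathcal P,\mathcal B,\mathcal I)$ is a simple $G$-locally $2$-homogeneous design (with $G$ acting by right multiplication), with $v=|G:H|$, $b=|G:K|$, $r=|H:H\cap K|$ and $k=|K:H\cap K|$.
   Context: A design is an incidence structure with finite point set $\mathcal P$ ($|\mathcal P|=v$) and block set $\mathcal B$ ($|\mathcal B|=b$), each block incident with exactly $k<v$ points, any two distinct points incident with exactly $\lambda>0$ common blocks; each point is then incident with $r$ blocks. It is simple if distinct blocks are incident with distinct sets of points. $\mathcal D(\gamma)$ denotes the set of elements incident with $\gamma\in\mathcal P\cup\mathcal B$. For $G\leqslant \mathrm{Aut}(\mathcal D)$, $\mathcal D$ is $G$-locally $2$-homogeneous if for every $\gamma\in\mathcal P\cup\mathcal B$ the stabilizer $G_\gamma$ acts $2$-homogeneously on $\mathcal D(\gamma)$. -}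

module Defs where

open import Data.Nat using (ℕ; _<_; _≥_)
open import Data.Fin using (Fin; _≟_)
open import Data.Fin.Properties using (any?)
open import Data.Fin.Subset using (Subset; _∈_; _∩_; Nonempty)
open import Data.Fin.Subset.Properties using (_∈?_)
open import Data.Vec using (tabulate)
open import Data.Product using (Σ; ∃; ∃₂; _×_; _,_)
open import Data.Product.Relation.Binary.Pointwise.NonDependent using ()
open import Data.Sum using (_⊎_)
open import Data.Unit using (⊤)
open import Relation.Nullary using (¬_; does)
open import Relation.Nullary.Decidable using (_×-dec_)
open import Relation.Binary.PropositionalEquality using (_≡_; _≢_)
open import Function.Definitions using (Injective)
open import Function.Bundles using (_⇔_)
open import Algebra.Structures using (IsGroup)

-- A finite group: a group structure (with propositional equality) on Fin n.
-- Every finite group is isomorphic to one of this form.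
record FinGroup : Set where
  field
    n       : ℕ
    _∙_     : Fin n → Fin n → Fin n
    ε       : Fin n
    _⁻¹     : Fin n → Fin n
    isGroup : IsGroup _≡_ _∙_ ε _⁻¹

module _ (G : FinGroup) where
  open FinGroup G

  record Subgroup : Set where
    field
      carrier : Subset n
      ε∈      : ε ∈ carrier
      ∙-closed : ∀ {x y} → x ∈ carrier → y ∈ carrier → (x ∙ y) ∈ carrier
      ⁻¹-closed : ∀ {x} → x ∈ carrier → (x ⁻¹) ∈ carrier

  -- Right multiplication of a subset by a group element:  S · g = { s ∙ g ∣ s ∈ S }.
  _·_ : Subset n → Fin n → Subset n
  S · g = tabulate (λ y → does (any? (λ s → (s ∈? S) ×-dec ((s ∙ g) ≟ y))))

  -- S is a right coset B a of B with a ∈ A   (the elements of [A : B]).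
  IsRightCoset : Subset n → Subset n → Subset n → Set
  IsRightCoset A B S = ∃ λ a → a ∈ A × S ≡ B · a

  HasSize : (Subset n → Set) → ℕ → Set
  HasSize P m = Σ (Fin m → Subset n) λ f →
    Injective _≡_ _≡_ f × (∀ i → P (f i)) × (∀ S → P S → ∃ λ i → f i ≡ S)

  AtLeastTwo : (Subset n → Set) → Set
  AtLeastTwo X = ∃₂ λ α β → X α × X β × α ≢ β

  TwoHomogeneous : (Fin n → Set) → (Subset n → Set) → Set
  TwoHomogeneous A X = AtLeastTwo X ×
    (∀ α β γ δ → X α → X β → X γ → X δ → α ≢ β → γ ≢ δ →
      ∃ λ a → A a × ((α · a ≡ γ × β · a ≡ δ) ⊎ (α · a ≡ δ × β · a ≡ γ)))

  Faithful : (Subset n → Set) → Set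
  Faithful X = ∀ g → (∀ S → X S → S · g ≡ S) → g ≡ ε

  record IsDesign (Pt Bl : Subset n → Set) (I : Subset n → Subset n → Set)
                  (v b r k lam : ℕ) : Set where
    field
      points   : HasSize Pt v
      blocks   : HasSize Bl b
      k<v      : k < v
      lam>0    : lam ≥ 1
      blockSize : ∀ B → Bl B → HasSize (λ p → Pt p × I p B) k
      pairCount : ∀ p q → Pt p → Pt q → p ≢ q →
                  HasSize (λ B → Bl B × I p B × I q B) lam
      replication : ∀ p → Pt p → HasSize (λ B → Bl B × I p B) r

  IsSimple : (Pt Bl : Subset n → Set) (I : Subset n → Subset n → Set) → Set
  IsSimple Pt Bl I = ∀ B B′ → Bl B → Bl B′ → B ≢ B′ →
    ¬ (∀ p → Pt p → (I p B ⇔ I p B′))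

  LocallyTwoHomogeneous : (Pt Bl : Subset n → Set) (I : Subset n → Subset n → Set) → Set
  LocallyTwoHomogeneous Pt Bl I =
    (∀ p → Pt p → TwoHomogeneous (λ g → p · g ≡ p) (λ B → Bl B × I p B)) ×
    (∀ B → Bl B → TwoHomogeneous (λ g → B · g ≡ B) (λ p → Pt p × I p B))

{-# OPTIONS --safe #-}

-- Right multiplication by G preserves points, blocks and incidence. For a point H x, the map
-- (H ∩ K) a ↦ K (a x) is a bijection from [H : H ∩ K] onto the blocks through H x under which
-- h ∈ H corresponds to x⁻¹ h x in the stabilizer of H x; this gives r and local 2-homogeneity at
-- points, and symmetrically k and local 2-homogeneity at blocks. Since G is 2-homogeneous on
-- points, the number of blocks through two points is constant. A point H g₀ y with g₀ ∉ H K misses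
-- the block K y, which gives k < v. Finally, if two blocks B ≠ B′ had the same points, then by
-- local 2-homogeneity so would all blocks through a point p of B; but some g ∈ G carries two
-- points of B onto p and a point q off B, so that B g is a block through p containing q.
module Submission where

open import Defs hiding (_·_)
import Defs
open import Data.Nat using (ℕ; zero; suc; _<_; _≥_; s≤s; z≤n)
open import Data.Bool.Properties as Bool using (T-≡)
open import Data.Fin using (Fin; zero; suc; punchOut; _≟_)
open import Data.Fin.Properties using (any?; ¬∀⟶∃¬; injective⇒≤; punchOut-injective; suc-injective)
open import Data.Fin.Subset using (Subset; _∈_; _∩_; ⊤; Nonempty)
open import Data.Fin.Subset.Properties using (_∈?_; ⊆-antisym; x∈p∩q⁺; x∈p∩q⁻; ∈⊤; ∩-comm; nonempty?)
open import Data.Vec.Properties as Vec using (lookup∘tabulate; []=⇒lookup; lookup⇒[]=)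
open import Data.Product using (Σ; ∃; ∃₂; _×_; _,_; proj₁; proj₂; map₂)
open import Data.Sum using (_⊎_; inj₁; inj₂)
import Data.Unit
open import Function using (_∘_)
open import Function.Bundles using (_⇔_; mk⇔; Equivalence)
import Function.Properties.Equivalence as ⇔
open import Function.Definitions using (Injective)
open import Level using (0ℓ)
open import Relation.Nullary using (¬_; Dec; yes; no; contradiction)
open import Relation.Nullary.Decidable using (_×-dec_; toWitness; isYes≗does; dec-true)
open import Relation.Binary.PropositionalEquality
open import Algebra.Bundles using (Group)
open import Algebra.Structures using (IsGroup)
import Algebra.Properties.Group as GroupProperties

enumerate-decidable : ∀ {m} (Q : Fin m → Set) → (∀ i → Dec (Q i)) →
  ∃ λ m′ → Σ (Fin m′ → Fin m) λ e →
    Injective _≡_ _≡_ e × (∀ j → Q (e j)) × (∀ i → Q i → ∃ λ j → e j ≡ i)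
enumerate-decidable {zero} Q Q? = zero , (λ ()) , (λ {}) , (λ ()) , (λ ())
enumerate-decidable {suc m} Q Q? with enumerate-decidable (Q ∘ suc) (Q? ∘ suc) | Q? zero
... | m′ , e , e-inj , e-Q , e-onto | yes Q0 = suc m′ , e′ , e′-inj , e′-Q , e′-onto
  where
  e′ : Fin (suc m′) → Fin (suc m)
  e′ zero    = zero
  e′ (suc j) = suc (e j)
  e′-inj : Injective _≡_ _≡_ e′
  e′-inj {zero}  {zero}  _  = refl
  e′-inj {suc i} {suc j} eq = cong suc (e-inj (suc-injective eq))
  e′-Q : ∀ j → Q (e′ j)
  e′-Q zero    = Q0
  e′-Q (suc j) = e-Q j
  e′-onto : ∀ i → Q i → ∃ λ j → e′ j ≡ i
  e′-onto zero    _  = zero , refl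
  e′-onto (suc i) Qi with e-onto i Qi
  ... | j , refl = suc j , refl
... | m′ , e , e-inj , e-Q , e-onto | no ¬Q0 = m′ , suc ∘ e , e-inj ∘ suc-injective , e-Q , e′-onto
  where
  e′-onto : ∀ i → Q i → ∃ λ j → suc (e j) ≡ i
  e′-onto zero    Q0 = contradiction Q0 ¬Q0
  e′-onto (suc i) Qi with e-onto i Qi
  ... | j , refl = j , refl

injective-missing⇒< : ∀ {k v} (f : Fin k → Fin v) → Injective _≡_ _≡_ f →
                      (j : Fin v) → (∀ i → f i ≢ j) → k < v
injective-missing⇒< {v = suc v} f f-inj j missed = s≤s (injective⇒≤ f′-inj)
  where
  j≢f : ∀ i → j ≢ f i
  j≢f i = missed i ∘ sym
  f′-inj : Injective _≡_ _≡_ (λ i → punchOut (j≢f i))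
  f′-inj eq = f-inj (punchOut-injective (j≢f _) (j≢f _) eq)

module _ (G : FinGroup) where
  open FinGroup G
  open IsGroup isGroup using (_//_; _\\_; assoc; identityʳ; inverseˡ; inverseʳ)

  group : Group 0ℓ 0ℓ
  group = record
    { Carrier = Fin n ; _≈_ = _≡_ ; _∙_ = _∙_ ; ε = ε ; _⁻¹ = _⁻¹ ; isGroup = isGroup }

  open GroupProperties group
    using (ε⁻¹≈ε; ⁻¹-anti-homo-∙; ⁻¹-involutive; //-rightDividesˡ; //-rightDividesʳ; \\-leftDividesˡ)

  ∙-//-∙ : ∀ a b y → (a ∙ y) // (b ∙ y) ≡ a // b
  ∙-//-∙ a b y = begin
    (a ∙ y) ∙ ((b ∙ y) ⁻¹)          ≡⟨ cong ((a ∙ y) ∙_) (⁻¹-anti-homo-∙ b y) ⟩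
    (a ∙ y) ∙ ((y ⁻¹) ∙ (b ⁻¹))     ≡⟨ assoc (a ∙ y) (y ⁻¹) (b ⁻¹) ⟨
    ((a ∙ y) // y) ∙ (b ⁻¹)         ≡⟨ cong (_∙ (b ⁻¹)) (//-rightDividesʳ y a) ⟩
    a // b                          ∎
    where open ≡-Reasoning

  //-∙-// : ∀ x a b → (x // a) ∙ (a // b) ≡ x // b
  //-∙-// x a b = begin
    (x // a) ∙ (a ∙ (b ⁻¹))     ≡⟨ assoc (x // a) a (b ⁻¹) ⟨
    ((x // a) ∙ a) ∙ (b ⁻¹)     ≡⟨ cong (_∙ (b ⁻¹)) (//-rightDividesˡ a x) ⟩
    x // b                      ∎
    where open ≡-Reasoning

  //-⁻¹ : ∀ a b → (a // b) ⁻¹ ≡ b // a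
  //-⁻¹ a b = trans (⁻¹-anti-homo-∙ a (b ⁻¹)) (cong (_∙ (a ⁻¹)) (⁻¹-involutive b))

  ∙-conjugate : ∀ a h x → (a ∙ x) ∙ (x \\ (h ∙ x)) ≡ (a ∙ h) ∙ x
  ∙-conjugate a h x = begin
    (a ∙ x) ∙ (x \\ (h ∙ x))   ≡⟨ assoc a x _ ⟩
    a ∙ (x ∙ (x \\ (h ∙ x)))   ≡⟨ cong (a ∙_) (\\-leftDividesˡ x (h ∙ x)) ⟩
    a ∙ (h ∙ x)                ≡⟨ assoc a h x ⟨
    (a ∙ h) ∙ x                ∎
    where open ≡-Reasoning

  infixl 8 _·_
  _·_ : Subset n → Fin n → Subset n
  _·_ = Defs._·_ G

  ∈·⇔ : ∀ {S g x} → x ∈ S · g ⇔ (∃ λ s → s ∈ S × s ∙ g ≡ x)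
  ∈·⇔ {S} {g} {x} = mk⇔
    (λ x∈ → toWitness (Equivalence.from T-≡
              (trans (isYes≗does s∙g≟x) (trans (sym (lookup∘tabulate _ x)) ([]=⇒lookup x∈)))))
    (λ s → lookup⇒[]= x (S · g) (trans (lookup∘tabulate _ x) (dec-true s∙g≟x s)))
    where
    s∙g≟x : Dec (∃ λ s → s ∈ S × s ∙ g ≡ x)
    s∙g≟x = any? (λ s → (s ∈? S) ×-dec ((s ∙ g) ≟ x))

  ∙∈· : ∀ {S g s} → s ∈ S → s ∙ g ∈ S · g
  ∙∈· s∈S = Equivalence.from ∈·⇔ (_ , s∈S , refl)

  ∈·⇒//∈ : ∀ {S g x} → x ∈ S · g → x // g ∈ S
  ∈·⇒//∈ {S} {g} x∈ with Equivalence.to ∈·⇔ x∈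
  ... | s , s∈S , refl = subst (_∈ S) (sym (//-rightDividesʳ g s)) s∈S

  //∈⇒∈· : ∀ {S g x} → x // g ∈ S → x ∈ S · g
  //∈⇒∈· {S} {g} {x} x//g∈S = Equivalence.from ∈·⇔ (x // g , x//g∈S , //-rightDividesˡ g x)

  ·-assoc : ∀ S g h → (S · g) · h ≡ S · (g ∙ h)
  ·-assoc S g h = ⊆-antisym
    (λ x∈ → //∈⇒∈· (subst (_∈ S) (//-// _) (∈·⇒//∈ (∈·⇒//∈ x∈))))
    (λ x∈ → //∈⇒∈· (//∈⇒∈· (subst (_∈ S) (sym (//-// _)) (∈·⇒//∈ x∈))))
    where
    //-// : ∀ x → (x // h) // g ≡ x // (g ∙ h)
    //-// x = trans (assoc x (h ⁻¹) (g ⁻¹)) (cong (x ∙_) (sym (⁻¹-anti-homo-∙ g h)))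

  ·-identityʳ : ∀ S → S · ε ≡ S
  ·-identityʳ S = ⊆-antisym
    (λ x∈ → subst (_∈ S) (x//ε≡x _) (∈·⇒//∈ x∈))
    (λ x∈ → //∈⇒∈· (subst (_∈ S) (sym (x//ε≡x _)) x∈))
    where
    x//ε≡x : ∀ x → x // ε ≡ x
    x//ε≡x x = trans (cong (x ∙_) ε⁻¹≈ε) (identityʳ x)

  ·-inverseʳ : ∀ S g → (S · g) · g ⁻¹ ≡ S
  ·-inverseʳ S g = trans (·-assoc S g (g ⁻¹)) (trans (cong (S ·_) (inverseʳ g)) (·-identityʳ S))

  ·-inverseˡ : ∀ S g → (S · g ⁻¹) · g ≡ S
  ·-inverseˡ S g = trans (·-assoc S (g ⁻¹) g) (trans (cong (S ·_) (inverseˡ g)) (·-identityʳ S))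

  ·-cancelʳ : ∀ {S T} g → S · g ≡ T · g → S ≡ T
  ·-cancelʳ {S} {T} g eq = begin
    S                  ≡⟨ ·-inverseʳ S g ⟨
    (S · g) · g ⁻¹     ≡⟨ cong (_· g ⁻¹) eq ⟩
    (T · g) · g ⁻¹     ≡⟨ ·-inverseʳ T g ⟩
    T                  ∎
    where open ≡-Reasoning

  Stabilizer : Subset n → Fin n → Set
  Stabilizer S g = S · g ≡ S

  meet : ∀ {S T : Subset n} {x} → x ∈ S → x ∈ T → Nonempty (S ∩ T)
  meet x∈S x∈T = _ , x∈p∩q⁺ (x∈S , x∈T)

  meet-· : ∀ {S T : Subset n} g → Nonempty (S ∩ T) → Nonempty (S · g ∩ T · g)
  meet-· {S} {T} g (x , x∈S∩T) with x∈p∩q⁻ S T x∈S∩T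
  ... | x∈S , x∈T = meet (∙∈· x∈S) (∙∈· x∈T)

  meet-comm : ∀ {S T : Subset n} → Nonempty (S ∩ T) → Nonempty (T ∩ S)
  meet-comm {S} {T} = subst Nonempty (∩-comm S T)

  module _ (X : Subgroup G) where
    open Subgroup X

    coset-⊆ : ∀ {a b} → a // b ∈ carrier → ∀ {x} → x ∈ carrier · a → x ∈ carrier · b
    coset-⊆ {a} {b} a//b∈X {x} x∈Xa =
      //∈⇒∈· (subst (_∈ carrier) (//-∙-// x a b) (∙-closed (∈·⇒//∈ x∈Xa) a//b∈X))

    coset≡⁺ : ∀ {a b} → a // b ∈ carrier → carrier · a ≡ carrier · b
    coset≡⁺ {a} {b} a//b∈X =
      ⊆-antisym (coset-⊆ a//b∈X) (coset-⊆ (subst (_∈ carrier) (//-⁻¹ a b) (⁻¹-closed a//b∈X)))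

    ∈-coset : ∀ a → a ∈ carrier · a
    ∈-coset a = //∈⇒∈· (subst (_∈ carrier) (sym (inverseʳ a)) ε∈)

    coset≡⁻ : ∀ {a b} → carrier · a ≡ carrier · b → a // b ∈ carrier
    coset≡⁻ {a} Xa≡Xb = ∈·⇒//∈ (subst (a ∈_) Xa≡Xb (∈-coset a))

    coset-of-∈ : ∀ {z x} → z ∈ carrier · x → carrier · z ≡ carrier · x
    coset-of-∈ z∈Xx = coset≡⁺ (∈·⇒//∈ z∈Xx)

  _∩ₛ_ : Subgroup G → Subgroup G → Subgroup G
  A ∩ₛ B = record
    { carrier   = carrier A ∩ carrier B
    ; ε∈        = x∈p∩q⁺ (ε∈ A , ε∈ B)
    ; ∙-closed  = λ x∈ y∈ → let (x∈A , x∈B) = x∈p∩q⁻ _ _ x∈ ; (y∈A , y∈B) = x∈p∩q⁻ _ _ y∈ in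
                    x∈p∩q⁺ (∙-closed A x∈A y∈A , ∙-closed B x∈B y∈B)
    ; ⁻¹-closed = λ x∈ → let (x∈A , x∈B) = x∈p∩q⁻ _ _ x∈ in
                    x∈p∩q⁺ (⁻¹-closed A x∈A , ⁻¹-closed B x∈B)
    }
    where open Subgroup

  HasSize-cong : ∀ {P Q : Subset n → Set} {m} →
    (∀ {S} → P S → Q S) → (∀ {S} → Q S → P S) → HasSize G P m → HasSize G Q m
  HasSize-cong P⇒Q Q⇒P (f , f-inj , f-P , f-onto) = f , f-inj , P⇒Q ∘ f-P , λ S → f-onto S ∘ Q⇒P

  HasSize-filter : ∀ {P : Subset n → Set} {m} (Q : Subset n → Set) → (∀ S → Dec (Q S)) →
    HasSize G P m → ∃ λ m′ → HasSize G (λ S → P S × Q S) m′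
  HasSize-filter {P} Q Q? (f , f-inj , f-P , f-onto)
    with enumerate-decidable (Q ∘ f) (Q? ∘ f)
  ... | m′ , e , e-inj , e-Q , e-onto =
    m′ , f ∘ e , e-inj ∘ f-inj , (λ j → f-P (e j) , e-Q j) , onto
    where
    onto : ∀ S → P S × Q S → ∃ λ j → f (e j) ≡ S
    onto S (PS , QS) with f-onto S PS
    ... | i , refl with e-onto i QS
    ... | j , refl = j , refl

  HasSize⇒≥1 : ∀ {P : Subset n → Set} {m S} → HasSize G P m → P S → m ≥ 1
  HasSize⇒≥1 {m = zero}  {S} (_ , _ , _ , f-onto) PS with () ← proj₁ (f-onto S PS)
  HasSize⇒≥1 {m = suc m} _ _ = s≤s z≤n

  HasSize-⊂⇒< : ∀ {P Q : Subset n → Set} {v k S₀} → HasSize G P v → HasSize G Q k →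
    (∀ {S} → Q S → P S) → P S₀ → ¬ Q S₀ → k < v
  HasSize-⊂⇒< {P} {Q} {v} {k} {S₀} (f , f-inj , f-P , f-onto) (g , g-inj , g-Q , g-onto) Q⇒P PS₀ ¬QS₀ =
    injective-missing⇒< index index-inj (proj₁ (f-onto S₀ PS₀)) missed
    where
    index : Fin k → Fin v
    index i = proj₁ (f-onto (g i) (Q⇒P (g-Q i)))
    f∘index : ∀ i → f (index i) ≡ g i
    f∘index i = proj₂ (f-onto (g i) (Q⇒P (g-Q i)))
    index-inj : Injective _≡_ _≡_ index
    index-inj {i} {j} eq = g-inj (trans (sym (f∘index i)) (trans (cong f eq) (f∘index j)))
    missed : ∀ i → index i ≢ proj₁ (f-onto S₀ PS₀)
    missed i eq =
      ¬QS₀ (subst Q (trans (sym (f∘index i)) (trans (cong f eq) (proj₂ (f-onto S₀ PS₀)))) (g-Q i))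

  record Correspondence (P Q : Subset n → Set) : Set₁ where
    field
      _∼_          : Subset n → Subset n → Set
      forth        : ∀ {S} → P S → ∃ λ T → Q T × S ∼ T
      back         : ∀ {T} → Q T → ∃ λ S → P S × S ∼ T
      ∼-injective  : ∀ {S S′ T} → S ∼ T → S′ ∼ T → S ≡ S′
      ∼-functional : ∀ {S T T′} → S ∼ T → S ∼ T′ → T ≡ T′

  HasSize-transport : ∀ {P Q : Subset n → Set} {m} → Correspondence P Q → HasSize G P m → HasSize G Q m
  HasSize-transport {Q = Q} {m} c (f , f-inj , f-P , f-onto) =
    image , image-inj , proj₁ ∘ proj₂ ∘ forth ∘ f-P , onto
    where
    open Correspondence c
    image : Fin m → Subset n
    image i = proj₁ (forth (f-P i))
    f∼image : ∀ i → f i ∼ image i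
    f∼image i = proj₂ (proj₂ (forth (f-P i)))
    image-inj : Injective _≡_ _≡_ image
    image-inj {i} {j} eq = f-inj (∼-injective (f∼image i) (subst (f j ∼_) (sym eq) (f∼image j)))
    onto : ∀ T → Q T → ∃ λ i → image i ≡ T
    onto T QT with back QT
    ... | S , PS , S∼T with f-onto S PS
    ... | i , refl = i , ∼-functional (f∼image i) S∼T

  HasSize-· : ∀ {P Q : Subset n → Set} {m} g →
    (∀ {S} → P S → Q (S · g)) → (∀ {T} → Q T → P (T · g ⁻¹)) → HasSize G P m → HasSize G Q m
  HasSize-· g P⇒Q Q⇒P = HasSize-transport record
    { _∼_          = λ S T → S · g ≡ T
    ; forth        = λ PS → _ , P⇒Q PS , refl
    ; back         = λ {T} QT → _ , Q⇒P QT , ·-inverseˡ T g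
    ; ∼-injective  = λ Sg≡T S′g≡T → ·-cancelʳ g (trans Sg≡T (sym S′g≡T))
    ; ∼-functional = λ Sg≡T Sg≡T′ → trans (sym Sg≡T) Sg≡T′
    }

  MapsPair : (Fin n → Set) → (α β γ δ : Subset n) → Set
  MapsPair A α β γ δ = ∃ λ a → A a × ((α · a ≡ γ × β · a ≡ δ) ⊎ (α · a ≡ δ × β · a ≡ γ))

  TwoHomogeneous-cong : ∀ {A : Fin n → Set} {X Y : Subset n → Set} →
    (∀ {S} → X S → Y S) → (∀ {S} → Y S → X S) → TwoHomogeneous G A X → TwoHomogeneous G A Y
  TwoHomogeneous-cong X⇒Y Y⇒X ((α , β , Xα , Xβ , α≢β) , maps) =
    (α , β , X⇒Y Xα , X⇒Y Xβ , α≢β) ,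
    λ α β γ δ Yα Yβ Yγ Yδ → maps α β γ δ (Y⇒X Yα) (Y⇒X Yβ) (Y⇒X Yγ) (Y⇒X Yδ)

  TwoHomogeneous-transport : ∀ {A A′ : Fin n → Set} {X Y : Subset n → Set}
    (c : Correspondence X Y) (φ : Fin n → Fin n) → let open Correspondence c in
    (∀ {g} → A g → A′ (φ g)) →
    (∀ {g S T} → A g → S ∼ T → (S · g) ∼ (T · φ g)) →
    TwoHomogeneous G A X → TwoHomogeneous G A′ Y
  TwoHomogeneous-transport {A} {A′} {X} {Y} c φ A⇒A′ intertwines (atLeastTwo , maps) =
    atLeastTwo′ atLeastTwo , λ α β γ δ → maps′
    where
    open Correspondence c
    atLeastTwo′ : AtLeastTwo G X → AtLeastTwo G Y
    atLeastTwo′ (α , β , Xα , Xβ , α≢β) with forth Xα | forth Xβ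
    ... | T , YT , α∼T | T′ , YT′ , β∼T′ =
      T , T′ , YT , YT′ , λ { refl → α≢β (∼-injective α∼T β∼T′) }
    distinct : ∀ {S S′ T T′} → S ∼ T → S′ ∼ T′ → T ≢ T′ → S ≢ S′
    distinct S∼T S∼T′ T≢T′ refl = T≢T′ (∼-functional S∼T S∼T′)
    moved : ∀ {g S S′ T T′} → A g → S ∼ T → S′ ∼ T′ → S · g ≡ S′ → T · φ g ≡ T′
    moved Ag S∼T S′∼T′ refl = ∼-functional (intertwines Ag S∼T) S′∼T′
    maps′ : ∀ {α β γ δ} → Y α → Y β → Y γ → Y δ → α ≢ β → γ ≢ δ → MapsPair A′ α β γ δ
    maps′ Yα Yβ Yγ Yδ α≢β γ≢δ
      with back Yα | back Yβ | back Yγ | back Yδ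
    ... | Sα , XSα , Sα∼α | Sβ , XSβ , Sβ∼β | Sγ , XSγ , Sγ∼γ | Sδ , XSδ , Sδ∼δ
      with maps Sα Sβ Sγ Sδ XSα XSβ XSγ XSδ (distinct Sα∼α Sβ∼β α≢β) (distinct Sγ∼γ Sδ∼δ γ≢δ)
    ... | g , Ag , inj₁ (e₁ , e₂) =
      φ g , A⇒A′ Ag , inj₁ (moved Ag Sα∼α Sγ∼γ e₁ , moved Ag Sβ∼β Sδ∼δ e₂)
    ... | g , Ag , inj₂ (e₁ , e₂) =
      φ g , A⇒A′ Ag , inj₂ (moved Ag Sα∼α Sδ∼δ e₁ , moved Ag Sβ∼β Sγ∼γ e₂)

  module Pencil (A B : Subgroup G) where
    private
      As Bs Cs : Subset n
      As = Subgroup.carrier A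
      Bs = Subgroup.carrier B
      C : Subgroup G
      C = A ∩ₛ B
      Cs = Subgroup.carrier C

    CosetsMeeting : Fin n → Subset n → Set
    CosetsMeeting x T = IsRightCoset G ⊤ Bs T × Nonempty (As · x ∩ T)

    _∼[_]_ : Subset n → Fin n → Subset n → Set
    S ∼[ x ] T = ∃ λ a → a ∈ As × S ≡ Cs · a × T ≡ Bs · (a ∙ x)

    correspondence : ∀ x → Correspondence (IsRightCoset G As Cs) (CosetsMeeting x)
    correspondence x = record
      { _∼_ = _∼[ x ]_ ; forth = forth ; back = back ; ∼-injective = injective ; ∼-functional = functional }
      where
      forth : ∀ {S} → IsRightCoset G As Cs S → ∃ λ T → CosetsMeeting x T × S ∼[ x ] T
      forth (a , a∈A , refl) =
        Bs · (a ∙ x) , ((a ∙ x , ∈⊤ , refl) , meet (∙∈· a∈A) (∈-coset B (a ∙ x))) ,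
        (a , a∈A , refl , refl)
      back : ∀ {T} → CosetsMeeting x T → ∃ λ S → IsRightCoset G As Cs S × S ∼[ x ] T
      back ((t , _ , refl) , z , z∈) with x∈p∩q⁻ _ _ z∈
      ... | z∈Ax , z∈Bt = Cs · (z // x) , (z // x , ∈·⇒//∈ z∈Ax , refl) ,
        (z // x , ∈·⇒//∈ z∈Ax , refl ,
         trans (sym (coset-of-∈ B z∈Bt)) (cong (Bs ·_) (sym (//-rightDividesˡ x z))))
      injective : ∀ {S S′ T} → S ∼[ x ] T → S′ ∼[ x ] T → S ≡ S′
      injective (a , a∈A , refl , T≡) (a′ , a′∈A , refl , T≡′) =
        coset≡⁺ C (x∈p∩q⁺ (a//a′∈A , a//a′∈B))
        where
        a//a′∈A : a // a′ ∈ As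
        a//a′∈A = Subgroup.∙-closed A a∈A (Subgroup.⁻¹-closed A a′∈A)
        a//a′∈B : a // a′ ∈ Bs
        a//a′∈B = subst (_∈ Bs) (∙-//-∙ a a′ x) (coset≡⁻ B (trans (sym T≡) T≡′))
      functional : ∀ {S T T′} → S ∼[ x ] T → S ∼[ x ] T′ → T ≡ T′
      functional (a , _ , S≡ , refl) (a′ , _ , S≡′ , refl) =
        coset≡⁺ B (subst (_∈ Bs) (sym (∙-//-∙ a a′ x)) a//a′∈B)
        where
        a//a′∈B : a // a′ ∈ Bs
        a//a′∈B = proj₂ (x∈p∩q⁻ As Bs (coset≡⁻ C (trans (sym S≡) S≡′)))

    pencil-size : ∀ {m} → HasSize G (IsRightCoset G As Cs) m → ∀ x → HasSize G (CosetsMeeting x) m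
    pencil-size size x = HasSize-transport (correspondence x) size

    -- h ∈ A acts on [A : A ∩ B] as its conjugate x⁻¹ h x acts on the B-cosets meeting A x.
    pencil-twoHomogeneous : TwoHomogeneous G (_∈ As) (IsRightCoset G As Cs) →
      ∀ x → TwoHomogeneous G (Stabilizer (As · x)) (CosetsMeeting x)
    pencil-twoHomogeneous hom x =
      TwoHomogeneous-transport (correspondence x) (λ h → x \\ (h ∙ x)) stabilizes intertwines hom
      where
      stabilizes : ∀ {h} → h ∈ As → As · x · (x \\ (h ∙ x)) ≡ As · x
      stabilizes {h} h∈A = begin
        As · x · (x \\ (h ∙ x))     ≡⟨ ·-assoc As x _ ⟩
        As · (x ∙ (x \\ (h ∙ x)))   ≡⟨ cong (As ·_) (\\-leftDividesˡ x (h ∙ x)) ⟩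
        As · (h ∙ x)                ≡⟨ coset≡⁺ A (subst (_∈ As) (sym (//-rightDividesʳ x h)) h∈A) ⟩
        As · x                      ∎
        where open ≡-Reasoning
      intertwines : ∀ {h S T} → h ∈ As → S ∼[ x ] T → (S · h) ∼[ x ] (T · (x \\ (h ∙ x)))
      intertwines {h} h∈A (a , a∈A , refl , refl) =
        a ∙ h , Subgroup.∙-closed A a∈A h∈A , ·-assoc Cs a h ,
        trans (·-assoc Bs (a ∙ x) _) (cong (Bs ·_) (∙-conjugate a h x))

  module InvariantIncidence (Pt Bl : Subset n → Set) (I : Subset n → Subset n → Set)
    (Pt-· : ∀ {p} g → Pt p → Pt (p · g))
    (Bl-· : ∀ {B} g → Bl B → Bl (B · g))
    (I-· : ∀ {p B} g → I p B → I (p · g) (B · g)) where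

    I-·⇔ : ∀ {p B} g → I p B ⇔ I (p · g) (B · g)
    I-·⇔ {p} {B} g = mk⇔ (I-· g) (subst₂ I (·-inverseʳ p g) (·-inverseʳ B g) ∘ I-· (g ⁻¹))

    BlocksThrough₂ : Subset n → Subset n → Subset n → Set
    BlocksThrough₂ p q B = Bl B × I p B × I q B

    BlocksThrough₂-· : ∀ {p q p′ q′ m} g → p · g ≡ p′ → q · g ≡ q′ →
      HasSize G (BlocksThrough₂ p q) m → HasSize G (BlocksThrough₂ p′ q′) m
    BlocksThrough₂-· g refl refl = HasSize-· g
      (λ (BlB , IpB , IqB) → Bl-· g BlB , I-· g IpB , I-· g IqB)
      (λ {T} (BlT , IpT , IqT) → Bl-· (g ⁻¹) BlT , I-·⁻¹ T IpT , I-·⁻¹ T IqT)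
      where
      I-·⁻¹ : ∀ {p} T → I (p · g) T → I p (T · g ⁻¹)
      I-·⁻¹ T = Equivalence.from (I-·⇔ g) ∘ subst (I _) (sym (·-inverseˡ T g))

    ConstantPairCount : ℕ → Set
    ConstantPairCount lam = lam ≥ 1 × (∀ p q → Pt p → Pt q → p ≢ q → HasSize G (BlocksThrough₂ p q) lam)

    constantPairCount : TwoHomogeneous G (λ _ → Data.Unit.⊤) Pt → (∀ p B → Dec (I p B)) →
      ∀ {B₀ b} → Bl B₀ → AtLeastTwo G (λ p → Pt p × I p B₀) → HasSize G Bl b → ∃ ConstantPairCount
    constantPairCount (_ , pointMaps) I? BlB₀ (p₀ , q₀ , (Pp₀ , Ip₀B₀) , (Pq₀ , Iq₀B₀) , p₀≢q₀) size
      with HasSize-filter (λ B → I p₀ B × I q₀ B) (λ B → I? p₀ B ×-dec I? q₀ B) size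
    ... | lam , size₀ = lam , HasSize⇒≥1 size₀ (BlB₀ , Ip₀B₀ , Iq₀B₀) , count
      where
      swap : ∀ {p q B} → BlocksThrough₂ p q B → BlocksThrough₂ q p B
      swap (BlB , IpB , IqB) = BlB , IqB , IpB
      count : ∀ p q → Pt p → Pt q → p ≢ q → HasSize G (BlocksThrough₂ p q) lam
      count p q Pp Pq p≢q with pointMaps p₀ q₀ p q Pp₀ Pq₀ Pp Pq p₀≢q₀ p≢q
      ... | g , _ , inj₁ (e₁ , e₂) = BlocksThrough₂-· g e₁ e₂ size₀
      ... | g , _ , inj₂ (e₁ , e₂) = HasSize-cong swap swap (BlocksThrough₂-· g e₁ e₂ size₀)

    SamePoints : Subset n → Subset n → Set
    SamePoints B B′ = ∀ p → Pt p → I p B ⇔ I p B′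

    SamePoints-· : ∀ {B B′} g → SamePoints B B′ → SamePoints (B · g) (B′ · g)
    SamePoints-· {B} {B′} g same p Pp =
      subst (λ q → I q (B · g) ⇔ I q (B′ · g)) (·-inverseˡ p g)
        (⇔.trans (⇔.sym (I-·⇔ g)) (⇔.trans (same _ (Pt-· (g ⁻¹) Pp)) (I-·⇔ g)))

    incident-image : ∀ {α β γ δ B g} → I α B → I β B →
      (α · g ≡ γ × β · g ≡ δ) ⊎ (α · g ≡ δ × β · g ≡ γ) → I γ (B · g) × I δ (B · g)
    incident-image {g = g} IαB IβB (inj₁ (refl , refl)) = I-· g IαB , I-· g IβB
    incident-image {g = g} IαB IβB (inj₂ (refl , refl)) = I-· g IβB , I-· g IαB

    isSimple : TwoHomogeneous G (λ _ → Data.Unit.⊤) Pt → LocallyTwoHomogeneous G Pt Bl I →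
      (∀ B → Bl B → ∃ λ q → Pt q × ¬ I q B) → IsSimple G Pt Bl I
    isSimple (_ , pointMaps) (pointLocal , blockLocal) offBlock B B′ BlB BlB′ B≢B′ same
      with proj₁ (blockLocal B BlB) | offBlock B BlB
    ... | p , p′ , (Pp , IpB) , (Pp′ , Ip′B) , p≢p′ | q , Pq , ¬IqB
      with pointMaps p p′ p q Pp Pp′ Pp Pq p≢p′ (λ { refl → ¬IqB IpB })
    ... | g , _ , moves with incident-image IpB Ip′B moves
    ... | IpBg , IqBg = ¬IqB (Equivalence.from (sameAsB (Bl-· g BlB) IpBg q Pq) IqBg)
      where
      sameAsB : ∀ {C} → Bl C → I p C → SamePoints B C
      sameAsB {C} BlC IpC with Vec.≡-dec Bool._≟_ B C
      ... | yes refl = λ _ _ → ⇔.refl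
      ... | no B≢C with proj₂ (pointLocal p Pp) B B′ B C
                          (BlB , IpB) (BlB′ , Equivalence.to (same p Pp) IpB) (BlB , IpB) (BlC , IpC) B≢B′ B≢C
      ... | h , _ , inj₁ (e₁ , e₂) = subst₂ SamePoints e₁ e₂ (SamePoints-· h same)
      ... | h , _ , inj₂ (e₁ , e₂) =
        subst₂ SamePoints e₂ e₁ (SamePoints-· h (λ r Pr → ⇔.sym (same r Pr)))

  module CosetGeometry (H K : Subgroup G) where
    private
      Hs Ks : Subset n
      Hs = Subgroup.carrier H
      Ks = Subgroup.carrier K

    Point Block : Subset n → Set
    Point = IsRightCoset G ⊤ Hs
    Block = IsRightCoset G ⊤ Ks

    Incident : Subset n → Subset n → Set
    Incident p B = Nonempty (p ∩ B)

    coset-· : ∀ {X S} g → IsRightCoset G ⊤ X S → IsRightCoset G ⊤ X (S · g)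
    coset-· {X} g (s , _ , refl) = s ∙ g , ∈⊤ , ·-assoc X s g

    open InvariantIncidence Point Block Incident coset-· coset-· meet-· public

    K-block : Block (Ks · ε)
    K-block = ε , ∈⊤ , refl

    incident? : ∀ p B → Dec (Incident p B)
    incident? p B = nonempty? (p ∩ B)

    replication : ∀ {r} → HasSize G (IsRightCoset G Hs (Hs ∩ Ks)) r →
      ∀ p → Point p → HasSize G (λ B → Block B × Incident p B) r
    replication size p (x , _ , refl) = Pencil.pencil-size H K size x

    blockSize : ∀ {k} → HasSize G (IsRightCoset G Ks (Hs ∩ Ks)) k →
      ∀ B → Block B → HasSize G (λ p → Point p × Incident p B) k
    blockSize {k} size B (y , _ , refl) = HasSize-cong (map₂ meet-comm) (map₂ meet-comm)
      (Pencil.pencil-size K H (subst (λ C → HasSize G (IsRightCoset G Ks C) k) (∩-comm Hs Ks) size) y)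

    locallyTwoHomogeneous :
      TwoHomogeneous G (_∈ Hs) (IsRightCoset G Hs (Hs ∩ Ks)) →
      TwoHomogeneous G (_∈ Ks) (IsRightCoset G Ks (Hs ∩ Ks)) →
      LocallyTwoHomogeneous G Point Block Incident
    locallyTwoHomogeneous homH homK = atPoint , atBlock
      where
      atPoint : ∀ p → Point p → TwoHomogeneous G (Stabilizer p) (λ B → Block B × Incident p B)
      atPoint p (x , _ , refl) = Pencil.pencil-twoHomogeneous H K homH x
      atBlock : ∀ B → Block B → TwoHomogeneous G (Stabilizer B) (λ p → Point p × Incident p B)
      atBlock B (y , _ , refl) = TwoHomogeneous-cong (map₂ meet-comm) (map₂ meet-comm)
        (Pencil.pencil-twoHomogeneous K H
          (subst (λ C → TwoHomogeneous G (_∈ Ks) (IsRightCoset G Ks C)) (∩-comm Hs Ks) homK) y)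

    InHK : Fin n → Set
    InHK g = ∃₂ λ h k → h ∈ Hs × k ∈ Ks × h ∙ k ≡ g

    inHK? : ∀ g → Dec (InHK g)
    inHK? g = any? λ h → any? λ k → (h ∈? Hs) ×-dec ((k ∈? Ks) ×-dec ((h ∙ k) ≟ g))

    -- A common element z of H g₀ y and K y factors g₀ as ((g₀ y) z⁻¹) (z y⁻¹) ∈ H K.
    ¬incident : ∀ {g₀} → ¬ InHK g₀ → ∀ y → ¬ Incident (Hs · (g₀ ∙ y)) (Ks · y)
    ¬incident {g₀} g₀∉HK y (z , z∈) with x∈p∩q⁻ _ _ z∈
    ... | z∈Hg₀y , z∈Ky = g₀∉HK
      ( (g₀ ∙ y) // z , z // y
      , subst (_∈ Hs) (//-⁻¹ z (g₀ ∙ y)) (Subgroup.⁻¹-closed H (∈·⇒//∈ z∈Hg₀y))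
      , ∈·⇒//∈ z∈Ky
      , trans (//-∙-// (g₀ ∙ y) z y) (//-rightDividesʳ y g₀) )

    pointOffBlock : ¬ (∀ g → InHK g) → ∀ B → Block B → ∃ λ q → Point q × ¬ Incident q B
    pointOffBlock G≢HK B (y , _ , refl) with ¬∀⟶∃¬ n InHK inHK? G≢HK
    ... | g₀ , g₀∉HK = Hs · (g₀ ∙ y) , (g₀ ∙ y , ∈⊤ , refl) , ¬incident g₀∉HK y

lemma2p4 : (G : FinGroup) (H K : Subgroup G) →
    let open FinGroup G
        Hs = Subgroup.carrier H
        Ks = Subgroup.carrier K
        Pt = IsRightCoset G ⊤ Hs
        Bl = IsRightCoset G ⊤ Ks
        I = λ (p B : Subset n) → Nonempty (p ∩ B)
    in ¬ (∀ g → ∃₂ λ h k → h ∈ Hs × k ∈ Ks × (h ∙ k) ≡ g) →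
       Faithful G Pt →
       TwoHomogeneous G (λ _ → Data.Unit.⊤) Pt →
       TwoHomogeneous G (λ h → h ∈ Hs) (IsRightCoset G Hs (Hs ∩ Ks)) →
       TwoHomogeneous G (λ k → k ∈ Ks) (IsRightCoset G Ks (Hs ∩ Ks)) →
       (v b r k : ℕ) →
       HasSize G Pt v →
       HasSize G Bl b →
       HasSize G (IsRightCoset G Hs (Hs ∩ Ks)) r →
       HasSize G (IsRightCoset G Ks (Hs ∩ Ks)) k →
       Σ ℕ (λ lam → IsDesign G Pt Bl I v b r k lam)
       × IsSimple G Pt Bl I
       × LocallyTwoHomogeneous G Pt Bl I
lemma2p4 G H K G≢HK _ pointHom homH homK v b r k v-size b-size r-size k-size =
  (lam , design) , isSimple pointHom local (pointOffBlock G≢HK) , local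
  where
  open CosetGeometry G H K
  local : LocallyTwoHomogeneous G Point Block Incident
  local = locallyTwoHomogeneous homH homK
  pairCount : ∃ ConstantPairCount
  pairCount = constantPairCount pointHom incident? K-block (proj₁ (proj₂ local _ K-block)) b-size
  lam : ℕ
  lam = proj₁ pairCount
  design : IsDesign G Point Block Incident v b r k lam
  design = record
    { points      = v-size
    ; blocks      = b-size
    ; k<v         = k<v
    ; lam>0       = proj₁ (proj₂ pairCount)
    ; blockSize   = blockSize k-size
    ; pairCount   = proj₂ (proj₂ pairCount)
    ; replication = replication r-size
    }
    where
    k<v : k < v
    k<v with pointOffBlock G≢HK _ K-block
    ... | q , Pq , ¬IqK = HasSize-⊂⇒< G v-size (blockSize k-size _ K-block) proj₁ Pq (¬IqK ∘ proj₂)
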